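{- Let $n\geq 1$ and let $i$ be an integer with $\lceil n/3\rceil\leq i\leq \lfloor n/2\rfloor$. Then $$d_a(P_n,i)\geq \sum_{k=3}^{i} d(P_{n-k},i-k+1)+\sum_{k=5}^{i+1} d(P_{n-k},i-k+2).$$
   Context: $P_m$ denotes the path on $m$ vertices. A dominating set of a graph $G=(V,E)$ is a set $D\subseteq V$ such that every vertex not in $D$ is adjacent to some vertex of $D$. A dominating set $D$ is accurate if no $|D|$-element subset of $V\setminus D$ is a dominating set of $G$. $d(G,j)$ is the number of dominating sets of $G$ of cardinality $j$ and $d_a(G,j)$ the number of accurate dominating sets of $G$ of cardinality $j$. Empty sums are $0$. -}

module Defs where

open import Data.Nat using (ℕ; zero; suc; _+_; _∸_; _≤_; _<_)
open import Data.Nat.DivMod using (_/_)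
open import Data.Fin using (Fin; toℕ)
open import Data.Fin.Subset using (Subset; _∈_; _∉_; ∣_∣; ⊤)
open import Data.Vec using (Vec; []; _∷_)
open import Data.Bool using (Bool; true; false)
open import Data.List using (List; []; _∷_; map; _++_; filter; length)
open import Data.Product using (Σ; ∃; _×_; _,_)
open import Data.Sum using (_⊎_)
open import Relation.Nullary using (¬_; Dec)
open import Relation.Nullary.Decidable using (_×-dec_; _⊎-dec_; ¬?; yes; no)
open import Data.Fin.Properties using (all?; any?)
import Data.Fin.Properties as FinP
open import Data.Fin.Subset using (_⊆_; ∁)
open import Data.Fin.Subset.Properties using (_∈?_; _⊆?_)
import Data.Nat as N
open import Data.List.Relation.Unary.All using (All)
import Data.List.Relation.Unary.All as All
open import Relation.Binary.PropositionalEquality using (_≡_)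

record Graph (m : ℕ) : Set₁ where
  field
    Adj : Fin m → Fin m → Set

open Graph public

Path : (m : ℕ) → Graph m
Adj (Path m) u v = (suc (toℕ u) ≡ toℕ v) ⊎ (suc (toℕ v) ≡ toℕ u)

IsDominating : ∀ {m} → Graph m → Subset m → Set
IsDominating {m} G D = (v : Fin m) → v ∉ D → ∃ λ u → u ∈ D × Adj G u v

allSubsets : (m : ℕ) → List (Subset m)
allSubsets zero = [] ∷ []
allSubsets (suc m) = map (true ∷_) (allSubsets m) ++ map (false ∷_) (allSubsets m)

IsAccurateDominating : ∀ {m} → Graph m → Subset m → Set
IsAccurateDominating {m} G D =
  IsDominating G D ×
  All (λ E → E ⊆ ∁ D → ∣ E ∣ ≡ ∣ D ∣ → ¬ IsDominating G E) (allSubsets m)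

pathAdj? : ∀ {m} (u v : Fin m) → Dec (Adj (Path m) u v)
pathAdj? u v = (suc (toℕ u) N.≟ toℕ v) ⊎-dec (suc (toℕ v) N.≟ toℕ u)

pathDom? : ∀ {m} (D : Subset m) → Dec (IsDominating (Path m) D)
pathDom? D = all? (λ v → ¬? (v ∈? D) →-dec any? (λ u → (u ∈? D) ×-dec pathAdj? u v))
  where
  _→-dec_ : ∀ {A B : Set} → Dec A → Dec B → Dec (A → B)
  _ →-dec yes b = yes (λ _ → b)
  no ¬a →-dec no _ = yes (λ a → ⊥-elim (¬a a))
    where open import Data.Empty using (⊥-elim)
  yes a →-dec no ¬b = no (λ f → ¬b (f a))

pathAcc? : ∀ {m} (D : Subset m) → Dec (IsAccurateDominating (Path m) D)
pathAcc? {m} D = pathDom? D ×-dec All.all? (λ E → (E ⊆? ∁ D) ⇒ ((∣ E ∣ N.≟ ∣ D ∣) ⇒ ¬? (pathDom? E))) (allSubsets m)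
  where
  _⇒_ : ∀ {A B : Set} → Dec A → Dec B → Dec (A → B)
  _ ⇒ yes b = yes (λ _ → b)
  no ¬a ⇒ no _ = yes (λ a → ⊥-elim (¬a a))
    where open import Data.Empty using (⊥-elim)
  yes a ⇒ no ¬b = no (λ f → ¬b (f a))

d : ℕ → ℕ → ℕ
d m j = length (filter (λ S → ∣ S ∣ N.≟ j) (filter pathDom? (allSubsets m)))

da : ℕ → ℕ → ℕ
da m j = length (filter (λ S → ∣ S ∣ N.≟ j) (filter pathAcc? (allSubsets m)))

-- Σ_{k=a}^{b} f k  (empty, i.e. 0, when b < a)
sumFromTo : ℕ → ℕ → (ℕ → ℕ) → ℕ
sumFromTo a b f = go a (suc b ∸ a)
  where
  go : ℕ → ℕ → ℕ
  go k zero = 0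
  go k (suc r) = f k + go (suc k) r

⌈_/3⌉ : ℕ → ℕ
⌈ n /3⌉ = (n + 2) / 3

-- A dominating set D is accurate as soon as some vertex has its closed neighbourhood inside D,
-- since no set disjoint from D can dominate that vertex. On P_n this applies to the sets
-- 1 X and 0 1 1 X, where X is a dominating set of the shorter path containing its first
-- vertex. Writing d₀(m, c) for the number of those, splitting off the second vertex gives
-- d₀(m+2, c+1) ≥ d₀(m+1, c) + d(m, c) (prefixes 1 1 and 1 0), and iterating this telescopes
-- into the two sums.
module Submission where

open import Defs
open import Data.Nat using (ℕ; zero; suc; _+_; _∸_; _≤_; _<_; z≤n; _≤?_; _≟_; ⌊_/2⌋)
open import Data.Nat.Properties
open import Data.Bool using (true; false)
open import Data.Vec using (_∷_; here; there)
open import Data.Fin using (Fin; zero; suc)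
open import Data.Fin.Subset using (Subset; _∈_; _⊆_; ∁; ∣_∣)
open import Data.Fin.Subset.Properties using (_∈?_; x∈∁p⇒x∉p)
open import Data.List using ([]; _∷_; _++_; map; filter; length)
open import Data.List.Properties using (filter-++; length-++)
open import Data.List.Relation.Binary.Sublist.Propositional using (⊆-refl)
open import Data.List.Relation.Binary.Sublist.Propositional.Properties using (filter⁺)
open import Data.List.Relation.Binary.Sublist.Heterogeneous.Properties using (length-mono-≤)
import Data.List.Relation.Unary.All as All
open import Data.Product using (∃; _×_; _,_)
open import Data.Sum using (inj₁; inj₂)
import Data.Sum as Sum
open import Data.Empty using (⊥; ⊥-elim)
open import Function using (_∘_)
open import Level using (0ℓ)
open import Relation.Nullary using (yes; no; does)
open import Relation.Nullary.Decidable using (_×-dec_)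
open import Relation.Unary using (Pred; Decidable)
open import Relation.Binary.PropositionalEquality

module _ {A : Set} where

  filter-filter : ∀ {P Q : Pred A 0ℓ} (P? : Decidable P) (Q? : Decidable Q) xs →
                  filter Q? (filter P? xs) ≡ filter (λ x → P? x ×-dec Q? x) xs
  filter-filter P? Q? [] = refl
  filter-filter P? Q? (x ∷ xs) with does (P? x)
  ... | false = filter-filter P? Q? xs
  ... | true with does (Q? x)
  ...   | true  = cong (x ∷_) (filter-filter P? Q? xs)
  ...   | false = filter-filter P? Q? xs

  length-filter-map : ∀ {B : Set} {P : Pred B 0ℓ} (P? : Decidable P) (f : A → B) xs →
                      length (filter P? (map f xs)) ≡ length (filter (P? ∘ f) xs)
  length-filter-map P? f [] = refl
  length-filter-map P? f (x ∷ xs) with does (P? (f x))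
  ... | true  = cong suc (length-filter-map P? f xs)
  ... | false = length-filter-map P? f xs

count : ∀ {m} {P : Pred (Subset m) 0ℓ} → Decidable P → ℕ
count {m} P? = length (filter P? (allSubsets m))

count-mono : ∀ {m} {P Q : Pred (Subset m) 0ℓ} (P? : Decidable P) (Q? : Decidable Q) →
             (∀ {S} → P S → Q S) → count P? ≤ count Q?
count-mono {m} P? Q? P⇒Q = length-mono-≤ (filter⁺ P? Q? (λ { refl → P⇒Q }) (⊆-refl {x = allSubsets m}))

count-suc : ∀ {m} {P : Pred (Subset (suc m)) 0ℓ} (P? : Decidable P) →
            count P? ≡ count (λ S → P? (true ∷ S)) + count (λ S → P? (false ∷ S))
count-suc {m} P? = begin
  length (filter P? (map (true ∷_) L ++ map (false ∷_) L))
    ≡⟨ cong length (filter-++ P? (map (true ∷_) L) _) ⟩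
  length (filter P? (map (true ∷_) L) ++ filter P? (map (false ∷_) L))
    ≡⟨ length-++ (filter P? (map (true ∷_) L)) ⟩
  length (filter P? (map (true ∷_) L)) + length (filter P? (map (false ∷_) L))
    ≡⟨ cong₂ _+_ (length-filter-map P? (true ∷_) L) (length-filter-map P? (false ∷_) L) ⟩
  count (λ S → P? (true ∷ S)) + count (λ S → P? (false ∷ S)) ∎
  where
  open ≡-Reasoning
  L = allSubsets m

count-∷-≤ : ∀ {m} {P : Pred (Subset (suc m)) 0ℓ} (P? : Decidable P) b →
            count (λ S → P? (b ∷ S)) ≤ count P?
count-∷-≤ P? true  rewrite count-suc P? = m≤m+n _ _
count-∷-≤ P? false rewrite count-suc P? = m≤n+m _ _

closedNbhd⊆⇒accurate : ∀ {m} {G : Graph m} {D : Subset m} {v : Fin m} →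
                       IsDominating G D → v ∈ D → (∀ {u} → Adj G u v → u ∈ D) →
                       IsAccurateDominating G D
closedNbhd⊆⇒accurate {m} {G} {D} {v} D-dom v∈D N⊆D =
  D-dom , All.tabulate (λ {E} _ E⊆∁D _ → ¬dominating E E⊆∁D)
  where
  ¬dominating : ∀ E → E ⊆ ∁ D → IsDominating G E → ⊥
  ¬dominating E E⊆∁D E-dom with v ∈? E
  ... | yes v∈E = x∈∁p⇒x∉p (E⊆∁D v∈E) v∈D
  ... | no v∉E  = let (u , u∈E , u~v) = E-dom v v∉E in x∈∁p⇒x∉p (E⊆∁D u∈E) (N⊆D u~v)

adj-suc : ∀ {m} {u v : Fin m} → Adj (Path m) u v → Adj (Path (suc m)) (suc u) (suc v)
adj-suc = Sum.map (cong suc) (cong suc)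

dominator-suc : ∀ {m} {S : Subset m} {v : Fin m} {b} →
                (∃ λ u → u ∈ S × Adj (Path m) u v) →
                ∃ λ u → u ∈ b ∷ S × Adj (Path (suc m)) u (suc v)
dominator-suc (u , u∈S , u~v) = suc u , there u∈S , adj-suc u~v

dominating-∷-head : ∀ {m} {S : Subset m} b → IsDominating (Path (suc m)) (true ∷ S) →
                    IsDominating (Path (suc (suc m))) (b ∷ true ∷ S)
dominating-∷-head b D-dom zero    _   = suc zero , there here , inj₂ refl
dominating-∷-head b D-dom (suc v) v∉D = dominator-suc (D-dom v (v∉D ∘ there))

dominating-true-false-∷ : ∀ {m} {S : Subset m} → IsDominating (Path m) S →
                          IsDominating (Path (suc (suc m))) (true ∷ false ∷ S)
dominating-true-false-∷ S-dom zero          v∉D = ⊥-elim (v∉D here)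
dominating-true-false-∷ S-dom (suc zero)    _   = zero , here , inj₁ refl
dominating-true-false-∷ S-dom (suc (suc v)) v∉D =
  dominator-suc (dominator-suc (S-dom v (v∉D ∘ there ∘ there)))

accurate-true-true-∷ : ∀ {m} {S : Subset m} → IsDominating (Path (suc (suc m))) (true ∷ true ∷ S) →
                       IsAccurateDominating (Path (suc (suc m))) (true ∷ true ∷ S)
accurate-true-true-∷ D-dom = closedNbhd⊆⇒accurate D-dom here N⊆D
  where
  N⊆D : ∀ {u} → Adj (Path _) u zero → u ∈ _
  N⊆D {zero}          (inj₁ ())
  N⊆D {zero}          (inj₂ ())
  N⊆D {suc zero}      _ = there here
  N⊆D {suc (suc u)}   (inj₁ ())
  N⊆D {suc (suc u)}   (inj₂ ())

accurate-false-true-true-true-∷ : ∀ {m} {S : Subset m} →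
  IsDominating (Path (suc (suc (suc (suc m))))) (false ∷ true ∷ true ∷ true ∷ S) →
  IsAccurateDominating (Path (suc (suc (suc (suc m))))) (false ∷ true ∷ true ∷ true ∷ S)
accurate-false-true-true-true-∷ D-dom = closedNbhd⊆⇒accurate D-dom (there (there here)) N⊆D
  where
  N⊆D : ∀ {u} → Adj (Path _) u (suc (suc zero)) → u ∈ _
  N⊆D {zero}                (inj₁ ())
  N⊆D {zero}                (inj₂ ())
  N⊆D {suc zero}            _ = there here
  N⊆D {suc (suc zero)}      (inj₁ ())
  N⊆D {suc (suc zero)}      (inj₂ ())
  N⊆D {suc (suc (suc zero))} _ = there (there (there here))
  N⊆D {suc (suc (suc (suc u)))} (inj₁ ())
  N⊆D {suc (suc (suc (suc u)))} (inj₂ ())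

dominatingOfSize? : ∀ {m} c → Decidable (λ (S : Subset m) → IsDominating (Path m) S × ∣ S ∣ ≡ c)
dominatingOfSize? c S = pathDom? S ×-dec (∣ S ∣ ≟ c)

accurateOfSize? : ∀ {m} c → Decidable (λ (S : Subset m) → IsAccurateDominating (Path m) S × ∣ S ∣ ≡ c)
accurateOfSize? c S = pathAcc? S ×-dec (∣ S ∣ ≟ c)

d≡count : ∀ m c → d m c ≡ count (dominatingOfSize? {m} c)
d≡count m c = cong length (filter-filter pathDom? (λ S → ∣ S ∣ ≟ c) (allSubsets m))

da≡count : ∀ m c → da m c ≡ count (accurateOfSize? {m} c)
da≡count m c = cong length (filter-filter pathAcc? (λ S → ∣ S ∣ ≟ c) (allSubsets m))

d₀ : ℕ → ℕ → ℕ
d₀ zero    c = 0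
d₀ (suc m) c = count (λ (S : Subset m) → dominatingOfSize? c (true ∷ S))

d+d₀≤d₀ : ∀ m c → d m c + d₀ (suc m) c ≤ d₀ (suc (suc m)) (suc c)
d+d₀≤d₀ m c = begin
  d m c + d₀ (suc m) c                   ≡⟨ cong (_+ d₀ (suc m) c) (d≡count m c) ⟩
  count (dominatingOfSize? {m} c) + d₀ (suc m) c
    ≤⟨ +-mono-≤ (count-mono (dominatingOfSize? c) (λ S → P? (false ∷ S)) prefix-10)
                (count-mono (λ S → dominatingOfSize? c (true ∷ S)) (λ S → P? (true ∷ S)) prefix-11) ⟩
  count (λ S → P? (false ∷ S)) + count (λ S → P? (true ∷ S))
    ≡⟨ +-comm (count (λ S → P? (false ∷ S))) _ ⟩
  count (λ S → P? (true ∷ S)) + count (λ S → P? (false ∷ S))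
    ≡⟨ sym (count-suc P?) ⟩
  d₀ (suc (suc m)) (suc c) ∎
  where
  open ≤-Reasoning
  P? = λ (S : Subset (suc m)) → dominatingOfSize? (suc c) (true ∷ S)
  prefix-10 : ∀ {S : Subset m} → IsDominating (Path m) S × ∣ S ∣ ≡ c →
              IsDominating (Path _) (true ∷ false ∷ S) × ∣ true ∷ false ∷ S ∣ ≡ suc c
  prefix-10 (S-dom , |S|≡c) = dominating-true-false-∷ S-dom , cong suc |S|≡c
  prefix-11 : ∀ {S : Subset m} → IsDominating (Path _) (true ∷ S) × ∣ true ∷ S ∣ ≡ c →
              IsDominating (Path _) (true ∷ true ∷ S) × ∣ true ∷ true ∷ S ∣ ≡ suc c
  prefix-11 (D-dom , |D|≡c) = dominating-∷-head true D-dom , cong suc |D|≡c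

sumFromTo-empty : ∀ {a b} f → b < a → sumFromTo a b f ≡ 0
sumFromTo-empty f b<a rewrite m≤n⇒m∸n≡0 b<a = refl

sumFromTo-step : ∀ {a b} f → a ≤ b → sumFromTo a b f ≡ f a + sumFromTo (suc a) b f
sumFromTo-step f a≤b rewrite +-∸-assoc 1 a≤b = refl

sumFromTo-telescope : ∀ {a b} (f F : ℕ → ℕ) → a ≤ suc b →
                      (∀ {k} → a ≤ k → k ≤ b → f k + F (suc k) ≤ F k) →
                      sumFromTo a b f + F (suc b) ≤ F a
sumFromTo-telescope {a} {b} f F a≤1+b step = go (suc b ∸ a) a (m∸n+n≡m a≤1+b) step
  where
  go : ∀ r a → r + a ≡ suc b → (∀ {k} → a ≤ k → k ≤ b → f k + F (suc k) ≤ F k) →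
       sumFromTo a b f + F (suc b) ≤ F a
  go zero    .(suc b) refl _ rewrite sumFromTo-empty {suc b} {b} f ≤-refl = ≤-refl
  go (suc r) a 1+r+a≡1+b step = begin
    sumFromTo a b f + F (suc b)             ≡⟨ cong (_+ F (suc b)) (sumFromTo-step f a≤b) ⟩
    f a + sumFromTo (suc a) b f + F (suc b) ≡⟨ +-assoc (f a) _ _ ⟩
    f a + (sumFromTo (suc a) b f + F (suc b))
      ≤⟨ +-monoʳ-≤ (f a) (go r (suc a) (trans (+-suc r a) 1+r+a≡1+b) (step ∘ ≤-trans (n≤1+n a))) ⟩
    f a + F (suc a)                         ≤⟨ step ≤-refl a≤b ⟩
    F a ∎
    where
    open ≤-Reasoning
    a≤b : a ≤ b
    a≤b = subst (a ≤_) (suc-injective 1+r+a≡1+b) (m≤n+m a r)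

d+d₀≤d₀-∸ : ∀ n i {k} → k ≤ i →
            d (n ∸ k) (suc i ∸ k) + d₀ (suc n ∸ k) (suc i ∸ k) ≤ d₀ (suc (suc n) ∸ k) (suc (suc i) ∸ k)
d+d₀≤d₀-∸ n i {k} k≤i rewrite +-∸-assoc 2 k≤i | +-∸-assoc 1 k≤i with k ≤? n
... | yes k≤n rewrite +-∸-assoc 2 k≤n | +-∸-assoc 1 k≤n = d+d₀≤d₀ (n ∸ k) (suc (i ∸ k))
... | no  k≰n rewrite m≤n⇒m∸n≡0 (≰⇒≥ k≰n) | m≤n⇒m∸n≡0 (≰⇒> k≰n) = z≤n

sum-d≤d₀ : ∀ n i k →
           sumFromTo k i (λ k → d (n ∸ k) (suc i ∸ k)) ≤ d₀ (suc (suc n) ∸ k) (suc (suc i) ∸ k)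
sum-d≤d₀ n i k with k ≤? suc i
... | yes k≤1+i = ≤-trans (m≤m+n _ _) (sumFromTo-telescope _ F k≤1+i (λ _ → d+d₀≤d₀-∸ n i))
  where
  F : ℕ → ℕ
  F k = d₀ (suc (suc n) ∸ k) (suc (suc i) ∸ k)
... | no  k≰1+i rewrite sumFromTo-empty {k} {i} (λ k → d (n ∸ k) (suc i ∸ k)) (<⇒≤ (≰⇒> k≰1+i)) = z≤n

+-suc-≡-∸ : ∀ k i {a} → suc a ≡ i ∸ k → k + suc a ≡ i
+-suc-≡-∸ zero    i       eq = eq
+-suc-≡-∸ (suc k) zero    ()
+-suc-≡-∸ (suc k) (suc i) eq = cong suc (+-suc-≡-∸ k i eq)

d₀≤accurate-head-true : ∀ m i → d₀ m (i ∸ 1) ≤ count (λ (S : Subset m) → accurateOfSize? i (true ∷ S))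
d₀≤accurate-head-true zero    i = z≤n
d₀≤accurate-head-true (suc m) i =
  ≤-trans (count-mono (λ S → dominatingOfSize? (i ∸ 1) (true ∷ S))
                      (λ S → accurateOfSize? i (true ∷ true ∷ S)) prefix-11)
          (count-∷-≤ (λ (S : Subset (suc m)) → accurateOfSize? i (true ∷ S)) true)
  where
  prefix-11 : ∀ {S : Subset m} → IsDominating (Path _) (true ∷ S) × ∣ true ∷ S ∣ ≡ i ∸ 1 →
              IsAccurateDominating (Path _) (true ∷ true ∷ S) × ∣ true ∷ true ∷ S ∣ ≡ i
  prefix-11 (D-dom , |D|≡i-1) =
    accurate-true-true-∷ (dominating-∷-head true D-dom) , +-suc-≡-∸ 1 i |D|≡i-1

d₀≤accurate-head-false : ∀ m i → d₀ (m ∸ 2) (i ∸ 2) ≤ count (λ (S : Subset m) → accurateOfSize? i (false ∷ S))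
d₀≤accurate-head-false zero                i = z≤n
d₀≤accurate-head-false (suc zero)          i = z≤n
d₀≤accurate-head-false (suc (suc zero))    i = z≤n
d₀≤accurate-head-false (suc (suc (suc m))) i = begin
  d₀ (suc m) (i ∸ 2)
    ≤⟨ count-mono (λ S → dominatingOfSize? (i ∸ 2) (true ∷ S))
                  (λ S → P? (true ∷ true ∷ true ∷ S)) prefix-0111 ⟩
  count (λ S → P? (true ∷ true ∷ true ∷ S)) ≤⟨ count-∷-≤ (λ S → P? (true ∷ true ∷ S)) true ⟩
  count (λ S → P? (true ∷ true ∷ S))        ≤⟨ count-∷-≤ (λ S → P? (true ∷ S)) true ⟩
  count (λ S → P? (true ∷ S))               ≤⟨ count-∷-≤ P? true ⟩
  count P? ∎
  where
  open ≤-Reasoning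
  P? = λ (S : Subset (suc (suc (suc m)))) → accurateOfSize? i (false ∷ S)
  prefix-0111 : ∀ {S : Subset m} → IsDominating (Path _) (true ∷ S) × ∣ true ∷ S ∣ ≡ i ∸ 2 →
                IsAccurateDominating (Path _) (false ∷ true ∷ true ∷ true ∷ S) ×
                ∣ false ∷ true ∷ true ∷ true ∷ S ∣ ≡ i
  prefix-0111 (D-dom , |D|≡i-2) =
    accurate-false-true-true-true-∷
      (dominating-∷-head false (dominating-∷-head true (dominating-∷-head true D-dom))) ,
    +-suc-≡-∸ 2 i |D|≡i-2

d₀+d₀≤da : ∀ n i → d₀ (n ∸ 1) (i ∸ 1) + d₀ (n ∸ 3) (i ∸ 2) ≤ da n i
d₀+d₀≤da zero    i = z≤n
d₀+d₀≤da (suc n) i = begin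
  d₀ n (i ∸ 1) + d₀ (n ∸ 2) (i ∸ 2)
    ≤⟨ +-mono-≤ (d₀≤accurate-head-true n i) (d₀≤accurate-head-false n i) ⟩
  count (λ (S : Subset n) → accurateOfSize? i (true ∷ S)) +
  count (λ (S : Subset n) → accurateOfSize? i (false ∷ S))
    ≡⟨ sym (count-suc (accurateOfSize? {suc n} i)) ⟩
  count (accurateOfSize? {suc n} i)                           ≡⟨ sym (da≡count (suc n) i) ⟩
  da (suc n) i ∎
  where open ≤-Reasoning

-- The bound holds for all n and i.
theorem3p3 : (n i : ℕ) → 1 ≤ n → ⌈ n /3⌉ ≤ i → i ≤ ⌊ n /2⌋ →
    sumFromTo 3 i (λ k → d (n ∸ k) ((i + 1) ∸ k)) + sumFromTo 5 (i + 1) (λ k → d (n ∸ k) ((i + 2) ∸ k))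
      ≤ da n i
theorem3p3 n i _ _ _ rewrite +-comm i 1 | +-comm i 2 =
  ≤-trans (+-mono-≤ (sum-d≤d₀ n i 3) (sum-d≤d₀ n (suc i) 5)) (d₀+d₀≤da n i)
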